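{- Let $\Pi$ be a $\mathsf{DATALOG}^r$ program whose extensional vocabulary is $\tau'=\{\mathbf{root},E,R_1,\dots,R_k\}$, let $m$ be as defined in the context, and let $\Pi^*$ be the translated program described in the context. Then for every intentional relation symbol $P$ of $\Pi$ and every $\mathbf T\in\mathcal T$, the relation $P^{\mathbf T[\Pi]}$ is an invariant relation on $\mathbf T$ and $(P^{\mathbf T[\Pi]})^*=(P^*)^{S_{\mathbf T}[\Pi^*]}$. Moreover, if $P$ is 0-ary, then $\mathbf T\models(\Pi,P)$ iff $S_{\mathbf T}\models(\Pi^*,P^*)$.
   Context: $\mathsf{DATALOG}^r$: a program is a finite set of rules $\beta\leftarrow\alpha_1,\dots,\alpha_l$, $\beta$ an atom; symbols in heads are intentional, others extensional; each $\alpha_i$ is an atom, a negated atom, or $\forall\bar yR\bar y\bar z$ with $R$ intentional; intentional symbols never occur negated; 0-ary symbols allowed. Semantics: least simultaneous fixed point obtained by iterating, from empty relations, $P^i_{(n+1)}=\{\bar a:(\mathbf A,P^1_{(n)},\dots)\models\phi_{P^i}[\bar a]\}$ where $\phi_{P^i}$ is the disjunction over rules with head $P^i\bar x_{P^i}$ of the existential closure of the body over variables other than $\bar x_{P^i}$; $P^{\mathbf A[\Pi]}$ is the fixed-point value; for 0-ary $P$, $\mathbf A\models(\Pi,P)$ iff the value is $\{\emptyset\}$. Trees: $\mathcal T$ is the class of finite structures $\langle V,\mathbf{root},E,R_1,\dots,R_k\rangle$ with $\langle V,E\rangle$ a perfect binary tree (edges parent-to-child), $\mathbf{root}$ its root,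 all $R_i$ saturated (membership of a tuple depends only on the depths of its entries). $d(a)$ = depth (root 0), levels $0,\dots,h-1$, $a\barwedge b$ = least common ancestor. Invariant relation: fixed by all automorphisms of $\langle V,E\rangle$; 0-ary relations count as invariant. Characteristic tuple of $(a_1,\dots,a_r)$: $(d(a_1),d(a_1\barwedge a_2),\dots,d(a_1\barwedge a_r),d(a_2),\dots,d(a_{r-1}\barwedge a_r),d(a_r))$; $R^*$ = set of characteristic tuples of elements of $R$ ($\emptyset^*=\emptyset$, $\{\emptyset\}^*=\{\emptyset\}$). $m$ is the maximum of the numbers of free variables of the rules of $\Pi$ and the arities of $R_1,\dots,R_k$ and of the intentional symbols; $FUL_m=V^m$. $S_{\mathbf T}$ has domain $\{0,\dots,h-1\}$, constant $\mathbf 0=0$, successor relation $SUCC$, and $R_{\neq},R_{\neg e},FUL_m^*,R_i^*,(\neg R_i)^*$ the characteristic relations of $\neq$, $V^2\setminus E$, $FUL_m$, $R_i$, $V^{r_i}\setminus R_i$. Translation $\Pi^*$: for each variable $x$ of $\Pi$ take a variable $i_x$, and for variables $x,y$ a variable $i_{x\barwedge y}$ ($i_{x\barwedge y}=i_{y\barwedge x}$, $i_{x\barwedge x}=i_x$); $(x_1\cdots x_r)^*$ denotes $i_{x_1}i_{x_1\barwedge x_2}\cdots i_{x_1\barwedge x_r}i_{x_2}\cdots i_{x_r}$. For each rule with free variables $v_1,\dots,v_n$, add $FUL_mv_1\cdots v_nv_n\cdots v_n$ (padded to length $m$) to the body, then replace: $x=y$ by $i_x=i_{x\barwedge y},i_{x\barwedge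 y}=i_y$; $i_{\mathbf{root}}$ and $i_{\mathbf{root}\barwedge x}$ by $\mathbf 0$; $Exy$ by $i_x=i_{x\barwedge y},SUCC\,i_{x\barwedge y}i_y$; $x\neq y$ by $R_{\neq}i_xi_{x\barwedge y}i_y$; $\neg Exy$ by $R_{\neg e}i_xi_{x\barwedge y}i_y$; $R\bar x$ by $R^*(\bar x)^*$ for $R\in\{R_1,\dots,R_k,FUL_m\}$ or $R$ a non-0-ary intentional symbol (including heads); $\neg R_i\bar x$ by $(\neg R_i)^*(\bar x)^*$; $\forall y_1\cdots\forall y_tRy_1\cdots y_tz_1\cdots z_s$ ($R$ intentional, non-0-ary) by the first-order formula $\Phi_R=FUL_m^*(z_1\cdots z_sz_s\cdots z_s)^*\wedge\forall(y_1\cdots y_t)^*\forall i_{y_1\barwedge z_1}\cdots\forall i_{y_t\barwedge z_s}(FUL_m^*(y_1\cdots y_tz_1\cdots z_sz_s\cdots z_s)^*\rightarrow R^*(y_1\cdots y_tz_1\cdots z_s)^*)$; each 0-ary intentional $P$ by $P^*$. $\Pi^*$ is evaluated on $S_{\mathbf T}$ with the same fixed-point semantics, each $\Phi_R$ in a body being evaluated as a first-order formula (it is positive in $R^*$). -}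

module Defs where

open import Data.Nat using (ℕ; zero; suc; _+_; _≤_; _<_; _⊔_; z≤n; s≤s)
open import Data.Nat.Properties using (≤-<-trans)
open import Data.Fin using (Fin; toℕ; fromℕ<) renaming (zero to fzero; suc to fsuc)
open import Data.Bool using (Bool; true; false; if_then_else_)
open import Data.List as L using (List; []; _∷_; length)
open import Data.List.Relation.Unary.Any as LAny using ()
open import Data.List.Relation.Unary.All as LAll using ()
open import Data.Vec as V using (Vec; []; _∷_; _++_)
open import Data.Vec.Relation.Unary.Any as VAny using ()
open import Data.Product using (Σ; ∃; _×_; _,_; proj₁; proj₂)
open import Data.Sum using (_⊎_; inj₁; inj₂)
open import Data.Empty using (⊥)
open import Data.Unit using (⊤)
open import Relation.Nullary using (¬_; yes; no)
open import Relation.Binary.PropositionalEquality using (_≡_; refl; sym; cong)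
open import Function.Bundles using (_⇔_)

-- Length of a characteristic tuple of an r-tuple: r(r+1)/2.
charLen : ℕ → ℕ
charLen zero    = zero
charLen (suc r) = suc r + charLen r

-- The "characteristic shape" of a tuple (a₁,…,a_r):
--   (f a₁, g a₁ a₂, …, g a₁ a_r, f a₂, g a₂ a₃, …, f a_r).
-- Used both for characteristic tuples of elements (f = depth,
-- g = depth of the least common ancestor) and for the variable
-- tuples (x₁⋯x_r)^* (f x = i_x, g x y = i_{x⊼y}).
charShape : ∀ {A B : Set} {r} → (A → B) → (A → A → B) → Vec A r → Vec B (charLen r)
charShape f g []       = []
charShape f g (a ∷ as) = f a ∷ (V.map (g a) as ++ charShape f g as)

-- Padding a tuple to length m with a default element (the paper pads
-- with the last entry; only ever used with length ≤ m).
padWith : ∀ {A : Set} {n} (m : ℕ) → A → Vec A n → Vec A m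
padWith zero    d xs       = []
padWith (suc m) d []       = d ∷ padWith m d []
padWith (suc m) d (x ∷ xs) = x ∷ padWith m d xs

padLast : ∀ {A : Set} {n} (m : ℕ) → Vec A (suc n) → Vec A m
padLast m xs = padWith m (V.last xs) xs

maxList : List ℕ → ℕ
maxList = L.foldr _⊔_ 0

maxFin : ∀ {k} → (Fin k → ℕ) → ℕ
maxFin f = maxList (L.tabulate f)

-- i_{x⊼y} as the canonical (min,max) pair; i_x = (x , x)
minmax : ∀ {n} → Fin n → Fin n → Fin n × Fin n
minmax x y with toℕ x Data.Nat.≤? toℕ y
... | yes _ = x , y
... | no  _ = y , x

-- τ' = {root, E, R₁,…,R_k}; the intentional symbols are Fin p.
record Schema : Set where
  field
    k   : ℕ
    rAr : Fin k → ℕ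
    p   : ℕ
    pAr : Fin p → ℕ
open Schema public

data Term (n : ℕ) : Set where
  var  : Fin n → Term n
  root : Term n

data Lit (S : Schema) (n : ℕ) : Set where
  eqL neqL   : Term n → Term n → Lit S n
  edgeL nedgeL : Term n → Term n → Lit S n
  relL nrelL : (i : Fin (k S)) → Vec (Term n) (rAr S i) → Lit S n
  intL       : (P : Fin (p S)) → Vec (Term n) (pAr S P) → Lit S n
  -- ∀y₁⋯∀y_{t+1} P y₁⋯y_{t+1} z₁⋯z_s  (P intentional, bound y's distinct, t+1 ≥ 1)
  allL       : (P : Fin (p S)) (t s : ℕ) → pAr S P ≡ suc t + s → Vec (Term n) s → Lit S n

record Rule (S : Schema) : Set where
  field
    nv    : ℕ
    head  : Fin (p S)
    hargs : Vec (Fin nv) (pAr S head)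
    body  : List (Lit S nv)
open Rule public

Program : Schema → Set
Program S = List (Rule S)

OccT : ∀ {n} → Fin n → Term n → Set
OccT x t = t ≡ var x

OccL : ∀ {S n} → Fin n → Lit S n → Set
OccL x (eqL t u)       = OccT x t ⊎ OccT x u
OccL x (neqL t u)      = OccT x t ⊎ OccT x u
OccL x (edgeL t u)     = OccT x t ⊎ OccT x u
OccL x (nedgeL t u)    = OccT x t ⊎ OccT x u
OccL x (relL i ts)     = VAny.Any (OccT x) ts
OccL x (nrelL i ts)    = VAny.Any (OccT x) ts
OccL x (intL P ts)     = VAny.Any (OccT x) ts
OccL x (allL P t s e zs) = VAny.Any (OccT x) zs

WellFormed : ∀ {S} → Program S → Set
WellFormed {S} Π =
  (∀ (P : Fin (p S)) → LAny.Any (λ ρ → head ρ ≡ P) Π)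
  × LAll.All (λ ρ → ∀ (x : Fin (nv ρ)) →
        VAny.Any (x ≡_) (hargs ρ) ⊎ LAny.Any (OccL x) (body ρ)) Π

mOf : ∀ {S} → Program S → ℕ
mOf {S} Π = maxList (L.map nv Π) ⊔ (maxFin (rAr S) ⊔ maxFin (pAr S))

-- Perfect binary trees (canonical presentation: nodes are the 0/1 paths
-- from the root of length < h)

record Node (h : ℕ) : Set where
  constructor node
  field
    path   : List Bool
    .bound : length path < h
open Node public

rootN : ∀ {h} → 1 ≤ h → Node h
rootN {h} le = node [] le

Edge : ∀ {h} → Node h → Node h → Set
Edge a b = ∃ λ (x : Bool) → path b ≡ path a L.∷ʳ x

lcp : List Bool → List Bool → List Bool
lcp (x ∷ xs) (y ∷ ys) with x Data.Bool.≟ y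
... | yes _ = x ∷ lcp xs ys
... | no  _ = []
lcp _ _ = []

lcp-≤ : ∀ xs ys → length (lcp xs ys) ≤ length xs
lcp-≤ [] ys = z≤n
lcp-≤ (x ∷ xs) [] = z≤n
lcp-≤ (x ∷ xs) (y ∷ ys) with x Data.Bool.≟ y
... | yes _ = s≤s (lcp-≤ xs ys)
... | no  _ = z≤n

lca : ∀ {h} → Node h → Node h → Node h
lca (node xs le) b = node (lcp xs (path b)) (≤-<-trans (lcp-≤ xs (path b)) le)

depth : ∀ {h} → Node h → Fin h
depth (node xs le) = fromℕ< le

charT : ∀ {h r} → Vec (Node h) r → Vec (Fin h) (charLen r)
charT = charShape depth (λ a b → depth (lca a b))

charSet : ∀ {h r} → (Vec (Node h) r → Set) → Vec (Fin h) (charLen r) → Set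
charSet R c = ∃ λ as → R as × charT as ≡ c

record Automorphism (h : ℕ) : Set where
  field
    to from  : Node h → Node h
    to-from  : ∀ a → to (from a) ≡ a
    from-to  : ∀ a → from (to a) ≡ a
    edge-pres : ∀ a b → Edge a b ⇔ Edge (to a) (to b)
open Automorphism public

Invariant : ∀ {h r} → (Vec (Node h) r → Set) → Set
Invariant {h} R = ∀ (f : Automorphism h) as → R as ⇔ R (V.map (to f) as)

record Tree (S : Schema) : Set₁ where
  field
    h     : ℕ
    h≥1   : 1 ≤ h
    R     : (i : Fin (k S)) → Vec (Node h) (rAr S i) → Set
    saturated : ∀ i (as bs : Vec (Node h) (rAr S i)) →
                V.map depth as ≡ V.map depth bs → R i as → R i bs
open Tree public

module _ {S : Schema} (T : Tree S) where

  Fact : Set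
  Fact = Σ (Fin (p S)) λ P → Vec (Node (h T)) (pAr S P)

  evalT : ∀ {n} → (Fin n → Node (h T)) → Term n → Node (h T)
  evalT σ (var x) = σ x
  evalT σ root    = rootN (h≥1 T)

  satL : ∀ {n} → (Fact → Set) → (Fin n → Node (h T)) → Lit S n → Set
  satL I σ (eqL t u)    = evalT σ t ≡ evalT σ u
  satL I σ (neqL t u)   = ¬ (evalT σ t ≡ evalT σ u)
  satL I σ (edgeL t u)  = Edge (evalT σ t) (evalT σ u)
  satL I σ (nedgeL t u) = ¬ Edge (evalT σ t) (evalT σ u)
  satL I σ (relL i ts)  = R T i (V.map (evalT σ) ts)
  satL I σ (nrelL i ts) = ¬ R T i (V.map (evalT σ) ts)
  satL I σ (intL P ts)  = I (P , V.map (evalT σ) ts)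
  satL I σ (allL P t s e zs) =
    ∀ (ys : Vec (Node (h T)) (suc t)) → I (P , V.cast (sym e) (ys ++ V.map (evalT σ) zs))

  stage : Program S → ℕ → Fact → Set
  stage Π zero    f = ⊥
  stage Π (suc j) f = LAny.Any (λ ρ → ∃ λ (σ : Fin (nv ρ) → Node (h T)) →
      ((head ρ , V.map σ (hargs ρ)) ≡ f) × LAll.All (satL (stage Π j) σ) (body ρ)) Π

  value : Program S → (P : Fin (p S)) → Vec (Node (h T)) (pAr S P) → Set
  value Π P as = ∃ λ j → stage Π j (P , as)

  models : Program S → (P : Fin (p S)) → pAr S P ≡ 0 → Set
  models Π P e = value Π P (V.cast (sym e) [])

data SRel (S : Schema) : Set where
  succR neqR nedgeR fulR : SRel S
  starR nstarR : Fin (k S) → SRel S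

sAr : ∀ {S} → ℕ → SRel S → ℕ
sAr m succR      = 2
sAr m neqR       = 3
sAr m nedgeR     = 3
sAr m fulR       = charLen m
sAr {S} m (starR i)  = charLen (rAr S i)
sAr {S} m (nstarR i) = charLen (rAr S i)

data STm (X : Set) : Set where
  tv : X → STm X
  t0 : STm X

data Fo (S : Schema) (m : ℕ) : Set → Set₁ where
  eqF  : ∀ {X} → STm X → STm X → Fo S m X
  relF : ∀ {X} (Q : SRel S) → Vec (STm X) (sAr m Q) → Fo S m X
  intF : ∀ {X} (P : Fin (p S)) → Vec (STm X) (charLen (pAr S P)) → Fo S m X
  andF : ∀ {X} → Fo S m X → Fo S m X → Fo S m X
  impF : ∀ {X} → Fo S m X → Fo S m X → Fo S m X
  allF : ∀ {X} (Y : Set) → Fo S m (X ⊎ Y) → Fo S m X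

record SRule (S : Schema) (m : ℕ) : Set₁ where
  field
    X     : Set
    shead : Fin (p S)
    sargs : Vec X (charLen (pAr S shead))
    sbody : List (Fo S m X)
open SRule public

SProgram : Schema → ℕ → Set₁
SProgram S m = List (SRule S m)

module Translate {S : Schema} (m : ℕ) where

  -- variables of a translated rule with n variables: i_x = (x,x),
  -- i_{x⊼y} = (min,max)
  IV : ℕ → Set
  IV n = Fin n × Fin n

  iT : ∀ {n} → Term n → STm (IV n)
  iT (var x) = tv (x , x)
  iT root    = t0

  iP : ∀ {n} → Term n → Term n → STm (IV n)
  iP (var x) (var y) = tv (minmax x y)
  iP _ _ = t0

  star : ∀ {n r} → Vec (Term n) r → Vec (STm (IV n)) (charLen r)
  star = charShape iT iP

  ful : ∀ {X : Set} {A : Set} {n} → (A → STm X) → (A → A → STm X) → Vec A n → List (Fo S m X)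
  ful f g []       = []
  ful f g (a ∷ as) = relF fulR (charShape f g (padLast m (a ∷ as))) ∷ []

  -- the entries of ∀ y₁⋯y_{t'} P y₁⋯y_{t'} z₁⋯z_s ; bound variables of Φ_P:
  -- i_{y_j}, i_{y_j⊼y_l} (as (min,max) pairs) and i_{y_j⊼x} for rule variables x
  module _ {n t' : ℕ} where
    Blk : Set
    Blk = (Fin t' × Fin t') ⊎ (Fin t' × Fin n)

    Ent : Set
    Ent = Fin t' ⊎ Term n

    up : STm (IV n) → STm (IV n ⊎ Blk)
    up (tv x) = tv (inj₁ x)
    up t0     = t0

    bT : Ent → STm (IV n ⊎ Blk)
    bT (inj₁ j) = tv (inj₂ (inj₁ (j , j)))
    bT (inj₂ z) = up (iT z)

    yz : Fin t' → Term n → STm (IV n ⊎ Blk)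
    yz j (var x) = tv (inj₂ (inj₂ (j , x)))
    yz j root    = t0

    bP : Ent → Ent → STm (IV n ⊎ Blk)
    bP (inj₁ j) (inj₁ l) = tv (inj₂ (inj₁ (minmax j l)))
    bP (inj₁ j) (inj₂ z) = yz j z
    bP (inj₂ z) (inj₁ j) = yz j z
    bP (inj₂ z) (inj₂ u) = up (iP z u)

  Φ : ∀ {n} (P : Fin (p S)) (t s : ℕ) → pAr S P ≡ suc t + s → Vec (Term n) s → List (Fo S m (IV n))
  Φ {n} P t s e zs =
       ful iT iP zs
    L.++ (allF (Blk {n} {suc t})
           (impF (relF fulR (charShape bT bP (padLast m ents)))
                 (intF P (charShape bT bP (V.cast (sym e) ents)))) ∷ [])
    where
      ents : Vec (Ent {n} {suc t}) (suc t + s)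
      ents = V.map inj₁ (V.allFin (suc t)) ++ V.map inj₂ zs

  trL : ∀ {n} → Lit S n → List (Fo S m (IV n))
  trL (eqL t u)    = eqF (iT t) (iP t u) ∷ eqF (iP t u) (iT u) ∷ []
  trL (neqL t u)   = relF neqR (star (t ∷ u ∷ [])) ∷ []
  trL (edgeL t u)  = eqF (iT t) (iP t u) ∷ relF succR (iP t u ∷ iT u ∷ []) ∷ []
  trL (nedgeL t u) = relF nedgeR (star (t ∷ u ∷ [])) ∷ []
  trL (relL i ts)  = relF (starR i) (star ts) ∷ []
  trL (nrelL i ts) = relF (nstarR i) (star ts) ∷ []
  trL (intL P ts)  = intF P (star ts) ∷ []
  trL (allL P t s e zs) = Φ P t s e zs

  trRule : Rule S → SRule S m
  trRule ρ = record
    { X     = IV (nv ρ)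
    ; shead = head ρ
    ; sargs = charShape (λ x → (x , x)) minmax (hargs ρ)
    ; sbody = ful iT iP (V.map var (V.allFin (nv ρ))) L.++ L.concatMap trL (body ρ)
    }

star : ∀ {S} → (Π : Program S) → SProgram S (mOf Π)
star Π = L.map (Translate.trRule (mOf Π)) Π

module _ {S : Schema} (T : Tree S) (m : ℕ) where

  private
    D = Fin (h T)

  SFact : Set
  SFact = Σ (Fin (p S)) λ P → Vec D (charLen (pAr S P))

  semR : (Q : SRel S) → Vec D (sAr m Q) → Set
  semR succR (i ∷ j ∷ [])  = toℕ j ≡ suc (toℕ i)
  semR neqR c       = charSet {h T} {2} (λ { (a ∷ b ∷ []) → ¬ (a ≡ b) }) c
  semR nedgeR c     = charSet {h T} {2} (λ { (a ∷ b ∷ []) → ¬ Edge a b }) c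
  semR fulR c       = charSet {h T} {m} (λ _ → ⊤) c
  semR (starR i) c  = charSet (R T i) c
  semR (nstarR i) c = charSet (λ as → ¬ R T i as) c

  evalS : ∀ {X} → (X → D) → STm X → D
  evalS σ (tv x) = σ x
  evalS σ t0     = fromℕ< (h≥1 T)

  satF : ∀ {X} → (SFact → Set) → (X → D) → Fo S m X → Set
  satF J σ (eqF a b)   = evalS σ a ≡ evalS σ b
  satF J σ (relF Q ts) = semR Q (V.map (evalS σ) ts)
  satF J σ (intF P ts) = J (P , V.map (evalS σ) ts)
  satF J σ (andF φ ψ)  = satF J σ φ × satF J σ ψ
  satF J σ (impF φ ψ)  = satF J σ φ → satF J σ ψ
  satF J σ (allF Y φ)  = ∀ (ρ : Y → D) → satF J (Data.Sum.[ σ , ρ ]) φ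

  satAll : ∀ {X} → (SFact → Set) → (X → D) → List (Fo S m X) → Set
  satAll J σ []       = ⊤
  satAll J σ (φ ∷ φs) = satF J σ φ × satAll J σ φs

  sstage : SProgram S m → ℕ → SFact → Set
  sstage Π zero    f = ⊥
  sstage Π (suc j) f = Σ (Fin (L.length Π)) λ i → ∃ λ (σ : X (L.lookup Π i) → D) →
      ((shead (L.lookup Π i) , V.map σ (sargs (L.lookup Π i))) ≡ f)
      × satAll (sstage Π j) σ (sbody (L.lookup Π i))

  svalue : SProgram S m → (P : Fin (p S)) → Vec D (charLen (pAr S P)) → Set
  svalue Π P c = ∃ λ j → sstage Π j (P , c)

  smodels : SProgram S m → (P : Fin (p S)) → pAr S P ≡ 0 → Set
  smodels Π P e = svalue Π P (V.cast (cong charLen (sym e)) [])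

-- Perfect binary trees are homogeneous: two tuples of nodes with the same characteristic tuple
-- differ by a map preserving depths and depths of least common ancestors, obtained by swapping,
-- at every node, the two subtrees as the tuples dictate (realign). Such maps fix the root and
-- preserve and reflect equality, edges and the saturated relations, so by induction every stage
-- of the fixed-point iteration of Π is determined by characteristic tuples; automorphisms fix the
-- root and preserve depths, which gives invariance the same way. Consequently a rule of Π fires
-- on a tuple exactly when its translation fires on the characteristic tuple: an assignment σ of
-- Π induces the assignment i_{x⊼y} ↦ d(σx ⊼ σy) of Π^*, and conversely the FUL_m atom forces
-- every assignment satisfying a translated body to arise from some σ. Induction on the stages
-- gives (P^{T[Π]})^* = (P^*)^{S_T[Π^*]}, and the 0-ary case is its instance at the empty tuple.

module Submission where

open import Defs
open import Data.Nat using (ℕ; zero; suc; _+_; _≤_; _<_; _≤?_; z≤n; s≤s)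
import Data.Nat.Properties as ℕ
open import Data.Fin using (Fin; toℕ) renaming (zero to fzero; suc to fsuc)
import Data.Fin.Properties as Fin
open import Data.Bool using (Bool; false; _xor_)
import Data.Bool as Bool
import Data.Bool.Properties as Bool
open import Data.List as L using (List; []; _∷_; length; _∷ʳ_; initLast; _∷ʳ′_)
open import Data.List.Properties using (length-++)
open import Data.List.Membership.Propositional using (_∈_)
open import Data.List.Relation.Unary.Any as Any using (here; there)
open import Data.List.Relation.Unary.All as All using ([]; _∷_)
open import Data.Vec as V using (Vec; []; _∷_; _++_)
import Data.Vec.Properties as V
open import Data.Product using (Σ; ∃; _×_; _,_; proj₁; proj₂; map₂)
open import Data.Sum using (_⊎_; inj₁; inj₂; [_,_])
open import Data.Empty using (⊥; ⊥-elim)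
open import Data.Unit using (⊤; tt)
open import Relation.Nullary using (yes; no)
open import Relation.Binary using (tri<; tri≈; tri>)
open import Relation.Binary.PropositionalEquality hiding ([_])
open import Function using (_∘_)
open import Function.Bundles using (_⇔_; mk⇔; Equivalence)
open import Function.Properties.Equivalence using () renaming (sym to ⇔-sym; trans to ⇔-trans)

-- Characteristic shapes

module _ {A B C : Set} where

  map-charShape : ∀ {r} (k : B → C) (f : A → B) (g : A → A → B) (v : Vec A r) →
    V.map k (charShape f g v) ≡ charShape (k ∘ f) (λ a b → k (g a b)) v
  map-charShape k f g [] = refl
  map-charShape k f g (a ∷ as) = cong (k (f a) ∷_) (begin
    V.map k (V.map (g a) as ++ charShape f g as)
      ≡⟨ V.map-++ k (V.map (g a) as) (charShape f g as) ⟩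
    V.map k (V.map (g a) as) ++ V.map k (charShape f g as)
      ≡⟨ cong₂ _++_ (sym (V.map-∘ k (g a) as)) (map-charShape k f g as) ⟩
    V.map (k ∘ g a) as ++ charShape (k ∘ f) (λ a b → k (g a b)) as ∎)
    where open ≡-Reasoning

  charShape-map : ∀ {r} (k : A → B) (f : B → C) (g : B → B → C) (v : Vec A r) →
    charShape f g (V.map k v) ≡ charShape (f ∘ k) (λ a b → g (k a) (k b)) v
  charShape-map k f g [] = refl
  charShape-map k f g (a ∷ as) =
    cong (f (k a) ∷_) (cong₂ _++_ (sym (V.map-∘ (g (k a)) k as)) (charShape-map k f g as))

charShape-cong : ∀ {A B : Set} {r} {f f′ : A → B} {g g′ : A → A → B} →
  (∀ a → f a ≡ f′ a) → (∀ a b → g a b ≡ g′ a b) → (v : Vec A r) → charShape f g v ≡ charShape f′ g′ v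
charShape-cong f≗f′ g≗g′ [] = refl
charShape-cong f≗f′ g≗g′ (a ∷ as) =
  cong₂ _∷_ (f≗f′ a) (cong₂ _++_ (V.map-cong (g≗g′ a) as) (charShape-cong f≗f′ g≗g′ as))

charShape-cast : ∀ {A B : Set} {r s} (f : A → B) (g : A → A → B) (e : r ≡ s) (v : Vec A r) →
  charShape f g (V.cast e v) ≡ V.cast (cong charLen e) (charShape f g v)
charShape-cast f g refl v = trans (cong (charShape f g) (V.cast-is-id refl v)) (sym (V.cast-is-id refl _))

module _ {A A′ B : Set} {f : A → B} {g : A → A → B} {f′ : A′ → B} {g′ : A′ → A′ → B} where

  charShape-∷-injective : ∀ {r} a (as : Vec A r) a′ (as′ : Vec A′ r) →
    charShape f g (a ∷ as) ≡ charShape f′ g′ (a′ ∷ as′) →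
    f a ≡ f′ a′ × V.map (g a) as ≡ V.map (g′ a′) as′ × charShape f g as ≡ charShape f′ g′ as′
  charShape-∷-injective a as a′ as′ eq with V.∷-injective eq
  ... | fa≡ , rest = fa≡ , V.++-injective (V.map (g a) as) (V.map (g′ a′) as′) rest

  charShape-++-injectiveʳ : ∀ {k r} (u : Vec A k) (v : Vec A r) (u′ : Vec A′ k) (v′ : Vec A′ r) →
    charShape f g (u ++ v) ≡ charShape f′ g′ (u′ ++ v′) → charShape f g v ≡ charShape f′ g′ v′
  charShape-++-injectiveʳ [] v [] v′ eq = eq
  charShape-++-injectiveʳ (a ∷ u) v (a′ ∷ u′) v′ eq =
    charShape-++-injectiveʳ u v u′ v′ (proj₂ (proj₂ (charShape-∷-injective a (u ++ v) a′ (u′ ++ v′) eq)))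

  charShape-truncate : ∀ {k r} (k≤r : k ≤ r) (v : Vec A r) (v′ : Vec A′ r) →
    charShape f g v ≡ charShape f′ g′ v′ → charShape f g (V.truncate k≤r v) ≡ charShape f′ g′ (V.truncate k≤r v′)
  charShape-truncate z≤n v v′ eq = refl
  charShape-truncate (s≤s k≤r) (a ∷ as) (a′ ∷ as′) eq with charShape-∷-injective a as a′ as′ eq
  ... | fa≡ , ga≡ , rest = cong₂ _∷_ fa≡ (cong₂ _++_
    (trans (sym (truncate-map (g a) k≤r as)) (trans (cong (V.truncate k≤r) ga≡) (truncate-map (g′ a′) k≤r as′)))
    (charShape-truncate k≤r as as′ rest))
    where
    truncate-map : ∀ {X Y : Set} {k r} (h : X → Y) (k≤r : k ≤ r) (xs : Vec X r) →
      V.truncate k≤r (V.map h xs) ≡ V.map h (V.truncate k≤r xs)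
    truncate-map h z≤n xs = refl
    truncate-map h (s≤s k≤r) (x ∷ xs) = cong (h x ∷_) (truncate-map h k≤r xs)

  charShape-lookup : ∀ {r} (v : Vec A r) (v′ : Vec A′ r) → charShape f g v ≡ charShape f′ g′ v′ →
    (∀ i → f (V.lookup v i) ≡ f′ (V.lookup v′ i)) ×
    (∀ i j → toℕ i < toℕ j → g (V.lookup v i) (V.lookup v j) ≡ g′ (V.lookup v′ i) (V.lookup v′ j))
  charShape-lookup [] [] eq = (λ ()) , (λ ())
  charShape-lookup (a ∷ as) (a′ ∷ as′) eq with charShape-∷-injective a as a′ as′ eq
  ... | fa≡ , ga≡ , rest with charShape-lookup as as′ rest
  ... | f≡ , g≡ = f∷≡ , g∷≡
    where
    f∷≡ : ∀ i → f (V.lookup (a ∷ as) i) ≡ f′ (V.lookup (a′ ∷ as′) i)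
    f∷≡ fzero = fa≡
    f∷≡ (fsuc i) = f≡ i
    g∷≡ : ∀ i j → toℕ i < toℕ j →
      g (V.lookup (a ∷ as) i) (V.lookup (a ∷ as) j) ≡ g′ (V.lookup (a′ ∷ as′) i) (V.lookup (a′ ∷ as′) j)
    g∷≡ fzero (fsuc j) _ =
      trans (sym (V.lookup-map j (g a) as)) (trans (cong (λ w → V.lookup w j) ga≡) (V.lookup-map j (g′ a′) as′))
    g∷≡ (fsuc i) (fsuc j) (s≤s i<j) = g≡ i j i<j

module _ {A : Set} where

  truncate-padWith : ∀ {k m} (k≤m : k ≤ m) (d : A) (v : Vec A k) → V.truncate k≤m (padWith m d v) ≡ v
  truncate-padWith z≤n d [] = refl
  truncate-padWith (s≤s k≤m) d (x ∷ v) = cong (x ∷_) (truncate-padWith k≤m d v)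

  padLast-map : ∀ {B : Set} {n} m (k : A → B) (v : Vec A (suc n)) → padLast m (V.map k v) ≡ V.map k (padLast m v)
  padLast-map m k v = trans (cong (λ d → padWith m d (V.map k v)) (last-map v)) (padWith-map m (V.last v) v)
    where
    last-map : ∀ {n} (v : Vec A (suc n)) → V.last (V.map k v) ≡ k (V.last v)
    last-map (x ∷ []) = refl
    last-map (x ∷ y ∷ v) = last-map (y ∷ v)
    padWith-map : ∀ {n} m d (v : Vec A n) → padWith m (k d) (V.map k v) ≡ V.map k (padWith m d v)
    padWith-map zero d v = refl
    padWith-map (suc m) d [] = cong (k d ∷_) (padWith-map m d [])
    padWith-map (suc m) d (x ∷ v) = cong (k x ∷_) (padWith-map m d v)

-- Common prefixes of paths

length-∷ʳ : ∀ (xs : List Bool) b → length (xs ∷ʳ b) ≡ suc (length xs)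
length-∷ʳ xs b = trans (length-++ xs) (ℕ.+-comm (length xs) 1)

lcpLen : List Bool → List Bool → ℕ
lcpLen xs ys = length (lcp xs ys)

module _ where
  private
    lcp-∷-≡ : ∀ x xs ys → lcp (x ∷ xs) (x ∷ ys) ≡ x ∷ lcp xs ys
    lcp-∷-≡ x xs ys with x Bool.≟ x
    ... | yes _ = refl
    ... | no x≢x = ⊥-elim (x≢x refl)

    lcp-[]ʳ : ∀ xs → lcp xs [] ≡ []
    lcp-[]ʳ [] = refl
    lcp-[]ʳ (x ∷ xs) = refl

  lcpLen-∷-≡ : ∀ x xs ys → lcpLen (x ∷ xs) (x ∷ ys) ≡ suc (lcpLen xs ys)
  lcpLen-∷-≡ x xs ys = cong length (lcp-∷-≡ x xs ys)

  lcpLen-∷-≢ : ∀ {x y} xs ys → x ≢ y → lcpLen (x ∷ xs) (y ∷ ys) ≡ 0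
  lcpLen-∷-≢ {x} {y} xs ys x≢y with x Bool.≟ y
  ... | yes x≡y = ⊥-elim (x≢y x≡y)
  ... | no _ = refl

  lcpLen-[]ʳ : ∀ xs → lcpLen xs [] ≡ 0
  lcpLen-[]ʳ xs = cong length (lcp-[]ʳ xs)

  lcpLen-refl : ∀ xs → lcpLen xs xs ≡ length xs
  lcpLen-refl [] = refl
  lcpLen-refl (x ∷ xs) = trans (lcpLen-∷-≡ x xs xs) (cong suc (lcpLen-refl xs))

  lcpLen-comm : ∀ xs ys → lcpLen xs ys ≡ lcpLen ys xs
  lcpLen-comm [] ys = sym (lcpLen-[]ʳ ys)
  lcpLen-comm (x ∷ xs) [] = refl
  lcpLen-comm (x ∷ xs) (y ∷ ys) with x Bool.≟ y
  ... | yes refl = trans (cong suc (lcpLen-comm xs ys)) (sym (lcpLen-∷-≡ x ys xs))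
  ... | no x≢y = sym (lcpLen-∷-≢ ys xs (x≢y ∘ sym))

  lcpLen-∷ʳ : ∀ xs b → lcpLen xs (xs ∷ʳ b) ≡ length xs
  lcpLen-∷ʳ [] b = refl
  lcpLen-∷ʳ (x ∷ xs) b = trans (lcpLen-∷-≡ x xs (xs ∷ʳ b)) (cong suc (lcpLen-∷ʳ xs b))

  lcpLen-∷⇒≡ : ∀ {n} x y xs ys → lcpLen (x ∷ xs) (y ∷ ys) ≡ suc n → x ≡ y
  lcpLen-∷⇒≡ x y xs ys eq with x Bool.≟ y
  ... | yes x≡y = x≡y
  ... | no _ = ⊥-elim (ℕ.0≢1+n eq)

≡⇔lcpLen : ∀ xs ys → xs ≡ ys ⇔ (length xs ≡ lcpLen xs ys × lcpLen xs ys ≡ length ys)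
≡⇔lcpLen xs ys = mk⇔ (λ { refl → sym (lcpLen-refl xs) , lcpLen-refl xs }) (λ (e₁ , e₂) → lengths⇒≡ xs ys e₁ e₂)
  where
  lengths⇒≡ : ∀ xs ys → length xs ≡ lcpLen xs ys → lcpLen xs ys ≡ length ys → xs ≡ ys
  lengths⇒≡ [] [] _ _ = refl
  lengths⇒≡ (x ∷ xs) (y ∷ ys) e₁ e₂ with lcpLen-∷⇒≡ x y xs ys (sym e₁)
  ... | refl = cong (x ∷_) (lengths⇒≡ xs ys
    (ℕ.suc-injective (trans e₁ (lcpLen-∷-≡ x xs ys))) (ℕ.suc-injective (trans (sym (lcpLen-∷-≡ x xs ys)) e₂)))

∷ʳ⇔lcpLen : ∀ xs ys → (∃ λ b → ys ≡ xs ∷ʳ b) ⇔ (length xs ≡ lcpLen xs ys × length ys ≡ suc (lcpLen xs ys))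
∷ʳ⇔lcpLen xs ys = mk⇔ ∷ʳ⇒lengths (λ (e₁ , e₂) → lengths⇒∷ʳ xs ys e₁ e₂)
  where
  ∷ʳ⇒lengths : (∃ λ b → ys ≡ xs ∷ʳ b) → length xs ≡ lcpLen xs ys × length ys ≡ suc (lcpLen xs ys)
  ∷ʳ⇒lengths (b , refl) = sym (lcpLen-∷ʳ xs b) , trans (length-∷ʳ xs b) (cong suc (sym (lcpLen-∷ʳ xs b)))
  lengths⇒∷ʳ : ∀ xs ys → length xs ≡ lcpLen xs ys → length ys ≡ suc (lcpLen xs ys) → ∃ λ b → ys ≡ xs ∷ʳ b
  lengths⇒∷ʳ [] (y ∷ []) _ _ = y , refl
  lengths⇒∷ʳ [] (y ∷ _ ∷ _) _ ()
  lengths⇒∷ʳ (x ∷ xs) (y ∷ ys) e₁ e₂ with lcpLen-∷⇒≡ x y xs ys (sym e₁)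
  ... | refl with lengths⇒∷ʳ xs ys (ℕ.suc-injective (trans e₁ (lcpLen-∷-≡ x xs ys)))
                            (ℕ.suc-injective (trans e₂ (cong suc (lcpLen-∷-≡ x xs ys))))
  ...   | b , refl = b , refl

-- Realigning paths along a correspondence

Correspondence : Set
Correspondence = List (List Bool × List Bool)

LcpPreserving : Correspondence → Set
LcpPreserving ps = ∀ {p q} → p ∈ ps → q ∈ ps → lcpLen (proj₁ p) (proj₁ q) ≡ lcpLen (proj₂ p) (proj₂ q)

headFlip : Correspondence → Bool
headFlip [] = false
headFlip ((c ∷ _ , d ∷ _) ∷ _) = c xor d
headFlip (_ ∷ ps) = headFlip ps

residual : Bool → Correspondence → Correspondence
residual b [] = []
residual b ((c ∷ u , d ∷ v) ∷ ps) with c Bool.≟ b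
... | yes _ = (u , v) ∷ residual b ps
... | no _ = residual b ps
residual b (_ ∷ ps) = residual b ps

realign : Correspondence → List Bool → List Bool
realign ps [] = []
realign ps (b ∷ x) = (b xor headFlip ps) ∷ realign (residual b ps) x

length-realign : ∀ ps x → length (realign ps x) ≡ length x
length-realign ps [] = refl
length-realign ps (b ∷ x) = cong suc (length-realign (residual b ps) x)

lcpLen-realign : ∀ ps x y → lcpLen (realign ps x) (realign ps y) ≡ lcpLen x y
lcpLen-realign ps [] y = refl
lcpLen-realign ps (b ∷ x) [] = refl
lcpLen-realign ps (b ∷ x) (b′ ∷ y) with b Bool.≟ b′
... | yes refl = trans (lcpLen-∷-≡ (b xor headFlip ps) _ _) (cong suc (lcpLen-realign (residual b ps) x y))
... | no b≢b′ = lcpLen-∷-≢ (realign (residual b ps) x) (realign (residual b′ ps) y) (b≢b′ ∘ xor-injectiveˡ)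
  where
  xor-injectiveˡ : ∀ {b b′ f} → b xor f ≡ b′ xor f → b ≡ b′
  xor-injectiveˡ {b} {b′} {f} e = begin
    b                   ≡⟨ sym (Bool.xor-identityʳ b) ⟩
    b xor false         ≡⟨ cong (b xor_) (sym (Bool.xor-same f)) ⟩
    b xor (f xor f)     ≡⟨ sym (Bool.xor-assoc b f f) ⟩
    (b xor f) xor f     ≡⟨ cong (_xor f) e ⟩
    (b′ xor f) xor f    ≡⟨ Bool.xor-assoc b′ f f ⟩
    b′ xor (f xor f)    ≡⟨ cong (b′ xor_) (Bool.xor-same f) ⟩
    b′ xor false        ≡⟨ Bool.xor-identityʳ b′ ⟩
    b′                  ∎
    where open ≡-Reasoning

module _ where
  private
    -- c ≡ c₀ iff the common prefix is nonempty iff d ≡ d₀.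
    heads-agree : ∀ c c₀ d d₀ u u₀ v v₀ →
      lcpLen (c ∷ u) (c₀ ∷ u₀) ≡ lcpLen (d ∷ v) (d₀ ∷ v₀) → c xor d ≡ c₀ xor d₀
    heads-agree c c₀ d d₀ u u₀ v v₀ eq with c Bool.≟ c₀
    ... | yes refl = cong (c xor_) (lcpLen-∷⇒≡ d d₀ v v₀ (sym eq))
    ... | no c≢c₀ = trans (cong₂ _xor_ (Bool.¬-not c≢c₀) (Bool.¬-not d≢d₀)) (Bool.xor-annihilates-not c₀ d₀)
      where
      d≢d₀ : d ≢ d₀
      d≢d₀ refl = ℕ.0≢1+n (trans eq (lcpLen-∷-≡ d v v₀))

    nonempty-empty-∉ : ∀ {ps} c u → LcpPreserving ps → (c ∷ u , []) ∈ ps → ⊥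
    nonempty-empty-∉ c u G m = ℕ.1+n≢0 (trans (sym (lcpLen-∷-≡ c u u)) (G m m))

  headFlip-correct : ∀ ps → LcpPreserving ps → ∀ {c u d v} → (c ∷ u , d ∷ v) ∈ ps → c xor headFlip ps ≡ d
  headFlip-correct (([] , _) ∷ ps) G (here ())
  headFlip-correct (([] , _) ∷ ps) G (there m) = headFlip-correct ps (λ m n → G (there m) (there n)) m
  headFlip-correct ((c₀ ∷ u₀ , []) ∷ ps) G m = ⊥-elim (nonempty-empty-∉ c₀ u₀ G (here refl))
  headFlip-correct ((c₀ ∷ u₀ , d₀ ∷ v₀) ∷ ps) G {c} {u} {d} {v} m = begin
    c xor (c₀ xor d₀)  ≡⟨ cong (c xor_) (sym (heads-agree c c₀ d d₀ u u₀ v v₀ (G m (here refl)))) ⟩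
    c xor (c xor d)    ≡⟨ sym (Bool.xor-assoc c c d) ⟩
    (c xor c) xor d    ≡⟨ cong (_xor d) (Bool.xor-same c) ⟩
    d                  ∎
    where open ≡-Reasoning

  ∈-residual : ∀ ps {c u d v} → (c ∷ u , d ∷ v) ∈ ps → (u , v) ∈ residual c ps
  ∈-residual ((c₀ ∷ u₀ , d₀ ∷ v₀) ∷ ps) {c} m with c₀ Bool.≟ c | m
  ... | yes _   | here refl = here refl
  ... | no c≢c  | here refl = ⊥-elim (c≢c refl)
  ... | yes _   | there m′  = there (∈-residual ps m′)
  ... | no _    | there m′  = ∈-residual ps m′
  ∈-residual (([] , _) ∷ ps) (there m) = ∈-residual ps m
  ∈-residual ((_ ∷ _ , []) ∷ ps) (there m) = ∈-residual ps m

  residual-∈ : ∀ ps c {u v} → (u , v) ∈ residual c ps → ∃ λ d → (c ∷ u , d ∷ v) ∈ ps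
  residual-∈ ((c₀ ∷ u₀ , d₀ ∷ v₀) ∷ ps) c m with c₀ Bool.≟ c | m
  ... | yes refl | here refl = d₀ , here refl
  ... | yes refl | there m′  = map₂ there (residual-∈ ps c m′)
  ... | no _     | m′        = map₂ there (residual-∈ ps c m′)
  residual-∈ (([] , _) ∷ ps) c m = map₂ there (residual-∈ ps c m)
  residual-∈ ((_ ∷ _ , []) ∷ ps) c m = map₂ there (residual-∈ ps c m)

  residual-LcpPreserving : ∀ ps c → LcpPreserving ps → LcpPreserving (residual c ps)
  residual-LcpPreserving ps c G {u₁ , v₁} {u₂ , v₂} m₁ m₂ with residual-∈ ps c m₁ | residual-∈ ps c m₂
  ... | d₁ , n₁ | d₂ , n₂ with lcpLen-∷⇒≡ d₁ d₂ v₁ v₂ (trans (sym (G n₁ n₂)) (lcpLen-∷-≡ c u₁ u₂))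
  ... | refl = ℕ.suc-injective (trans (sym (lcpLen-∷-≡ c u₁ u₂)) (trans (G n₁ n₂) (lcpLen-∷-≡ d₁ v₁ v₂)))

  realign-correct : ∀ ps → LcpPreserving ps → ∀ {u v} → (u , v) ∈ ps → realign ps u ≡ v
  realign-correct ps G {[]} {[]} m = refl
  realign-correct ps G {[]} {d ∷ v} m = ⊥-elim (ℕ.0≢1+n (trans (G m m) (lcpLen-∷-≡ d v v)))
  realign-correct ps G {c ∷ u} {[]} m = ⊥-elim (nonempty-empty-∉ c u G m)
  realign-correct ps G {c ∷ u} {d ∷ v} m = cong₂ _∷_ (headFlip-correct ps G m)
    (realign-correct (residual c ps) (residual-LcpPreserving ps c G) (∈-residual ps m))

-- Depths in perfect binary trees

module _ {h : ℕ} where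

  Node-≡ : ∀ {a b : Node h} → path a ≡ path b → a ≡ b
  Node-≡ {node xs _} {node .xs _} refl = refl

  lcaDepth : Node h → Node h → Fin h
  lcaDepth a b = depth (lca a b)

  toℕ-depth : ∀ (a : Node h) → toℕ (depth a) ≡ length (path a)
  toℕ-depth (node xs xs<h) = Fin.toℕ-fromℕ< xs<h

  toℕ-lcaDepth : ∀ (a b : Node h) → toℕ (lcaDepth a b) ≡ lcpLen (path a) (path b)
  toℕ-lcaDepth (node xs _) b = Fin.toℕ-fromℕ< _

  lcaDepth-comm : ∀ a b → lcaDepth a b ≡ lcaDepth b a
  lcaDepth-comm a b = Fin.toℕ-injective (begin
    toℕ (lcaDepth a b)      ≡⟨ toℕ-lcaDepth a b ⟩
    lcpLen (path a) (path b) ≡⟨ lcpLen-comm (path a) (path b) ⟩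
    lcpLen (path b) (path a) ≡⟨ toℕ-lcaDepth b a ⟨
    toℕ (lcaDepth b a)      ∎)
    where open ≡-Reasoning

  lcaDepth-self : ∀ a → lcaDepth a a ≡ depth a
  lcaDepth-self a = Fin.toℕ-injective (trans (toℕ-lcaDepth a a) (trans (lcpLen-refl (path a)) (sym (toℕ-depth a))))

  lcaDepth-rootʳ : ∀ a (1≤h : 1 ≤ h) → lcaDepth a (rootN 1≤h) ≡ depth (rootN {h} 1≤h)
  lcaDepth-rootʳ a 1≤h = Fin.toℕ-injective
    (trans (toℕ-lcaDepth a (rootN 1≤h)) (trans (lcpLen-[]ʳ (path a)) (sym (toℕ-depth (rootN {h} 1≤h)))))

  lcaDepth-rootˡ : ∀ a (1≤h : 1 ≤ h) → lcaDepth (rootN 1≤h) a ≡ depth (rootN {h} 1≤h)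
  lcaDepth-rootˡ a 1≤h = trans (lcaDepth-comm (rootN 1≤h) a) (lcaDepth-rootʳ a 1≤h)

  ≡⇔depths : ∀ (a b : Node h) → a ≡ b ⇔ (depth a ≡ lcaDepth a b × lcaDepth a b ≡ depth b)
  ≡⇔depths a b = mk⇔ (λ { refl → sym (lcaDepth-self a) , lcaDepth-self a }) λ (e₁ , e₂) →
    Node-≡ (Equivalence.from (≡⇔lcpLen (path a) (path b))
      ( trans (sym (toℕ-depth a)) (trans (cong toℕ e₁) (toℕ-lcaDepth a b))
      , trans (sym (toℕ-lcaDepth a b)) (trans (cong toℕ e₂) (toℕ-depth b))))

  Edge⇔depths : ∀ (a b : Node h) → Edge a b ⇔ (depth a ≡ lcaDepth a b × toℕ (depth b) ≡ suc (toℕ (lcaDepth a b)))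
  Edge⇔depths a b = mk⇔
    (λ e → let (e₁ , e₂) = Equivalence.to (∷ʳ⇔lcpLen (path a) (path b)) e in
      Fin.toℕ-injective (trans (toℕ-depth a) (trans e₁ (sym (toℕ-lcaDepth a b))))
      , trans (toℕ-depth b) (trans e₂ (cong suc (sym (toℕ-lcaDepth a b)))))
    (λ (e₁ , e₂) → Equivalence.from (∷ʳ⇔lcpLen (path a) (path b))
      ( trans (sym (toℕ-depth a)) (trans (cong toℕ e₁) (toℕ-lcaDepth a b))
      , trans (sym (toℕ-depth b)) (trans e₂ (cong suc (toℕ-lcaDepth a b)))))

-- Rooted isometries

record RootedIsometry (h : ℕ) : Set where
  field
    apply          : Node h → Node h
    depth-apply    : ∀ a → depth (apply a) ≡ depth a
    lcaDepth-apply : ∀ a b → lcaDepth (apply a) (apply b) ≡ lcaDepth a b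
open RootedIsometry

module _ {h : ℕ} (f : RootedIsometry h) where

  apply-root : (1≤h : 1 ≤ h) → apply f (rootN 1≤h) ≡ rootN 1≤h
  apply-root 1≤h = Node-≡ (length≡0 (path (apply f (rootN 1≤h)))
    (trans (sym (toℕ-depth (apply f (rootN 1≤h))))
      (trans (cong toℕ (depth-apply f (rootN 1≤h))) (toℕ-depth (rootN {h} 1≤h)))))
    where
    length≡0 : ∀ (xs : List Bool) → length xs ≡ 0 → xs ≡ []
    length≡0 [] _ = refl

  private
    depths-apply : ∀ a b →
      (depth (apply f a) ≡ lcaDepth (apply f a) (apply f b)) ⇔ (depth a ≡ lcaDepth a b)
    depths-apply a b = mk⇔
      (λ e → trans (sym (depth-apply f a)) (trans e (lcaDepth-apply f a b)))
      (λ e → trans (depth-apply f a) (trans e (sym (lcaDepth-apply f a b))))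

  apply-injective : ∀ a b → apply f a ≡ apply f b → a ≡ b
  apply-injective a b e with Equivalence.to (≡⇔depths (apply f a) (apply f b)) e
  ... | e₁ , e₂ = Equivalence.from (≡⇔depths a b)
    (Equivalence.to (depths-apply a b) e₁ , trans (sym (lcaDepth-apply f a b)) (trans e₂ (depth-apply f b)))

  Edge-apply : ∀ a b → Edge a b ⇔ Edge (apply f a) (apply f b)
  Edge-apply a b = mk⇔
    (λ e → let (e₁ , e₂) = Equivalence.to (Edge⇔depths a b) e in
      Equivalence.from (Edge⇔depths (apply f a) (apply f b)) (Equivalence.from (depths-apply a b) e₁ ,
        trans (cong toℕ (depth-apply f b)) (trans e₂ (cong (suc ∘ toℕ) (sym (lcaDepth-apply f a b))))))
    (λ e → let (e₁ , e₂) = Equivalence.to (Edge⇔depths (apply f a) (apply f b)) e in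
      Equivalence.from (Edge⇔depths a b) (Equivalence.to (depths-apply a b) e₁ ,
        trans (cong toℕ (sym (depth-apply f b))) (trans e₂ (cong (suc ∘ toℕ) (lcaDepth-apply f a b)))))

  charT-apply : ∀ {r} (as : Vec (Node h) r) → charT (V.map (apply f) as) ≡ charT as
  charT-apply as =
    trans (charShape-map (apply f) depth lcaDepth as) (charShape-cong (depth-apply f) (lcaDepth-apply f) as)

-- Homogeneity

module _ {h : ℕ} where

  realignNode : Correspondence → Node h → Node h
  realignNode ps (node xs xs<h) = node (realign ps xs) (subst (_< h) (sym (length-realign ps xs)) xs<h)

  realignIsometry : Correspondence → RootedIsometry h
  realignIsometry ps = record
    { apply          = realignNode ps
    ; depth-apply    = λ { a@(node xs _) → Fin.toℕ-injective
        (trans (toℕ-depth (realignNode ps a)) (trans (length-realign ps xs) (sym (toℕ-depth a)))) }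
    ; lcaDepth-apply = λ { a@(node xs _) b@(node ys _) → Fin.toℕ-injective
        (trans (toℕ-lcaDepth (realignNode ps a) (realignNode ps b))
          (trans (lcpLen-realign ps xs ys) (sym (toℕ-lcaDepth a b)))) }
    }

  correspondence : ∀ {r} → Vec (Node h) r → Vec (Node h) r → Correspondence
  correspondence [] [] = []
  correspondence (u ∷ us) (v ∷ vs) = (path u , path v) ∷ correspondence us vs

  private
    lcpLen-correspondence : ∀ {r} u v (us vs : Vec (Node h) r) → V.map (lcaDepth u) us ≡ V.map (lcaDepth v) vs →
      ∀ {q} → q ∈ correspondence us vs → lcpLen (path u) (proj₁ q) ≡ lcpLen (path v) (proj₂ q)
    lcpLen-correspondence u v [] [] e ()
    lcpLen-correspondence u v (u₁ ∷ us) (v₁ ∷ vs) e (here refl) =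
      trans (sym (toℕ-lcaDepth u u₁)) (trans (cong toℕ (V.∷-injectiveˡ e)) (toℕ-lcaDepth v v₁))
    lcpLen-correspondence u v (u₁ ∷ us) (v₁ ∷ vs) e (there m) =
      lcpLen-correspondence u v us vs (V.∷-injectiveʳ e) m

  correspondence-LcpPreserving : ∀ {r} (us vs : Vec (Node h) r) → charT us ≡ charT vs →
    LcpPreserving (correspondence us vs)
  correspondence-LcpPreserving [] [] e ()
  correspondence-LcpPreserving (u ∷ us) (v ∷ vs) e with charShape-∷-injective u us v vs e
  ... | e₁ , e₂ , e₃ = preserving
    where
    preserving : LcpPreserving (correspondence (u ∷ us) (v ∷ vs))
    preserving (here refl) (here refl) = begin
      lcpLen (path u) (path u) ≡⟨ lcpLen-refl (path u) ⟩
      length (path u)          ≡⟨ toℕ-depth u ⟨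
      toℕ (depth u)            ≡⟨ cong toℕ e₁ ⟩
      toℕ (depth v)            ≡⟨ toℕ-depth v ⟩
      length (path v)          ≡⟨ lcpLen-refl (path v) ⟨
      lcpLen (path v) (path v) ∎
      where open ≡-Reasoning
    preserving (here refl) (there n) = lcpLen-correspondence u v us vs e₂ n
    preserving {p} (there m) (here refl) = trans (lcpLen-comm (proj₁ p) (path u))
      (trans (lcpLen-correspondence u v us vs e₂ m) (lcpLen-comm (path v) (proj₂ p)))
    preserving (there m) (there n) = correspondence-LcpPreserving us vs e₃ m n

  charT-cast : ∀ {r s} (eq : r ≡ s) (us vs : Vec (Node h) r) → charT us ≡ charT vs →
    charT (V.cast eq us) ≡ charT (V.cast eq vs)
  charT-cast eq us vs e = trans (charShape-cast depth lcaDepth eq us)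
    (trans (cong (V.cast (cong charLen eq)) e) (sym (charShape-cast depth lcaDepth eq vs)))

  charT-homogeneous : ∀ {r} (us vs : Vec (Node h) r) → charT us ≡ charT vs →
    Σ (RootedIsometry h) λ f → V.map (apply f) us ≡ vs
  charT-homogeneous us vs e = realignIsometry ps , realign-map us vs (λ m → m)
    where
    ps = correspondence us vs
    realign-map : ∀ {r} (us vs : Vec (Node h) r) → (∀ {q} → q ∈ correspondence us vs → q ∈ ps) →
      V.map (realignNode ps) us ≡ vs
    realign-map [] [] _ = refl
    realign-map (node _ _ ∷ us) (v ∷ vs) ⊆ps = cong₂ _∷_
      (Node-≡ (realign-correct ps (correspondence-LcpPreserving _ _ e) (⊆ps (here refl))))
      (realign-map us vs (⊆ps ∘ there))

  charT-extend : ∀ {k r} (ws : Vec (Node h) k) (vs zs : Vec (Node h) r) → charT vs ≡ charT zs →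
    ∃ λ ys → charT (ys ++ zs) ≡ charT (ws ++ vs)
  charT-extend ws vs zs e with charT-homogeneous vs zs e
  ... | f , refl = V.map (apply f) ws , (begin
    charT (V.map (apply f) ws ++ V.map (apply f) vs) ≡⟨ cong charT (V.map-++ (apply f) ws vs) ⟨
    charT (V.map (apply f) (ws ++ vs))              ≡⟨ charT-apply f (ws ++ vs) ⟩
    charT (ws ++ vs)                                ∎)
    where open ≡-Reasoning

  CharDetermined : ∀ {r} → (Vec (Node h) r → Set) → Set
  CharDetermined R = ∀ as bs → charT as ≡ charT bs → R as → R bs

  isometry-closed⇒CharDetermined : ∀ {r} {R : Vec (Node h) r → Set} →
    (∀ f as → R as → R (V.map (apply f) as)) → CharDetermined R
  isometry-closed⇒CharDetermined closed as bs e Ras with charT-homogeneous as bs e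
  ... | f , refl = closed f as Ras

  charSet-charT : ∀ {r} {R : Vec (Node h) r → Set} → CharDetermined R → ∀ bs → charSet R (charT bs) ⇔ R bs
  charSet-charT det bs = mk⇔ (λ (as , Ras , e) → det as bs e Ras) (λ Rbs → bs , Rbs , refl)

-- Automorphisms

module _ {h : ℕ} where

  length-Edge : ∀ (a b : Node h) → Edge a b → length (path b) ≡ suc (length (path a))
  length-Edge a b (x , eq) = trans (cong length eq) (length-∷ʳ (path a) x)

  root-or-child : (1≤h : 1 ≤ h) (a : Node h) → a ≡ rootN 1≤h ⊎ ∃ λ p → Edge p a
  root-or-child 1≤h (node xs xs<h) with initLast xs
  ... | [] = inj₁ (Node-≡ refl)
  ... | ys ∷ʳ′ y = inj₂ (node ys (ℕ.<-trans (ℕ.n<1+n _) (subst (_< h) (length-∷ʳ ys y) xs<h)) , y , refl)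

  module _ (A : Automorphism h) (1≤h : 1 ≤ h) where

    to-root : to A (rootN 1≤h) ≡ rootN 1≤h
    to-root with root-or-child 1≤h (to A (rootN 1≤h))
    ... | inj₁ e = e
    ... | inj₂ (p , p→r) = ⊥-elim (ℕ.0≢1+n (length-Edge (from A p) (rootN 1≤h)
      (Equivalence.from (edge-pres A (from A p) (rootN 1≤h))
        (subst (λ q → Edge q (to A (rootN 1≤h))) (sym (to-from A p)) p→r))))

    private
      length-to : ∀ n (a : Node h) → length (path a) ≡ n → length (path (to A a)) ≡ n
      length-to n a eq with root-or-child 1≤h a
      ... | inj₁ refl = trans (cong (length ∘ path) to-root) eq
      length-to zero a eq | inj₂ (p , p→a) = ⊥-elim (ℕ.1+n≢0 (trans (sym (length-Edge p a p→a)) eq))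
      length-to (suc n) a eq | inj₂ (p , p→a) =
        trans (length-Edge (to A p) (to A a) (Equivalence.to (edge-pres A p a) p→a))
        (cong suc (length-to n p (ℕ.suc-injective (trans (sym (length-Edge p a p→a)) eq))))

    depth-to : ∀ a → depth (to A a) ≡ depth a
    depth-to a = Fin.toℕ-injective (trans (toℕ-depth (to A a)) (trans (length-to _ a refl) (sym (toℕ-depth a))))

  map-to-from : (A : Automorphism h) {r : ℕ} (as : Vec (Node h) r) → V.map (to A) (V.map (from A) as) ≡ as
  map-to-from A as = trans (sym (V.map-∘ (to A) (from A) as)) (trans (V.map-cong (to-from A) as) (V.map-id as))

  Automorphism-inverse : Automorphism h → Automorphism h
  Automorphism-inverse A = record
    { to = from A ; from = to A ; to-from = from-to A ; from-to = to-from A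
    ; edge-pres = λ a b → mk⇔
        (λ e → Equivalence.from (edge-pres A (from A a) (from A b))
                 (subst₂ Edge (sym (to-from A a)) (sym (to-from A b)) e))
        (λ e → subst₂ Edge (to-from A a) (to-from A b) (Equivalence.to (edge-pres A (from A a) (from A b)) e))
    }

-- Stages along depth-preserving embeddings

record DepthEmbedding (h : ℕ) : Set where
  field
    embed           : Node h → Node h
    embed-root      : (1≤h : 1 ≤ h) → embed (rootN 1≤h) ≡ rootN 1≤h
    embed-injective : ∀ a b → embed a ≡ embed b → a ≡ b
    Edge-embed      : ∀ a b → Edge a b ⇔ Edge (embed a) (embed b)
    depth-embed     : ∀ a → depth (embed a) ≡ depth a
open DepthEmbedding

map-depth-embed : ∀ {h r} (e : DepthEmbedding h) (as : Vec (Node h) r) →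
  V.map depth (V.map (embed e) as) ≡ V.map depth as
map-depth-embed e as = trans (sym (V.map-∘ depth (embed e) as)) (V.map-cong (depth-embed e) as)

RootedIsometry⇒DepthEmbedding : ∀ {h} → RootedIsometry h → DepthEmbedding h
RootedIsometry⇒DepthEmbedding f = record
  { embed           = apply f
  ; embed-root      = apply-root f
  ; embed-injective = apply-injective f
  ; Edge-embed      = Edge-apply f
  ; depth-embed     = depth-apply f
  }

Automorphism⇒DepthEmbedding : ∀ {h} → 1 ≤ h → Automorphism h → DepthEmbedding h
Automorphism⇒DepthEmbedding 1≤h A = record
  { embed           = to A
  ; embed-root      = λ _ → to-root A 1≤h
  ; embed-injective = λ a b e → trans (sym (from-to A a)) (trans (cong (from A) e) (from-to A b))
  ; Edge-embed      = edge-pres A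
  ; depth-embed     = depth-to A 1≤h
  }

module _ {S : Schema} (T : Tree S) where

  consequence : (Fact T → Set) → Program S → Fact T → Set
  consequence I Π fact = Any.Any (λ ρ → ∃ λ (σ : Fin (nv ρ) → Node (h T)) →
    ((head ρ , V.map σ (hargs ρ)) ≡ fact) × All.All (satL T I σ) (body ρ)) Π

  ∀-closed-lit : (Fact T → Set) → ∀ P t s → pAr S P ≡ suc t + s → Vec (Node (h T)) s → Set
  ∀-closed-lit I P t s eq zs = ∀ ys → I (P , V.cast (sym eq) (ys ++ zs))

  module _ (e : DepthEmbedding (h T)) (I : Fact T → Set)
    (I-embed : ∀ P as → I (P , as) → I (P , V.map (embed e) as))
    (∀-closed-embed : ∀ P t s eq zs → ∀-closed-lit I P t s eq zs → ∀-closed-lit I P t s eq (V.map (embed e) zs))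
    where

    private
      eval-embed : ∀ {n} (σ : Fin n → Node (h T)) t → evalT T (embed e ∘ σ) t ≡ embed e (evalT T σ t)
      eval-embed σ (var x) = refl
      eval-embed σ root = sym (embed-root e (h≥1 T))

      map-eval-embed : ∀ {n r} (σ : Fin n → Node (h T)) (ts : Vec (Term n) r) →
        V.map (evalT T (embed e ∘ σ)) ts ≡ V.map (embed e) (V.map (evalT T σ) ts)
      map-eval-embed σ ts = trans (V.map-cong (eval-embed σ) ts) (V.map-∘ (embed e) (evalT T σ) ts)

    satL-embed : ∀ {n} (σ : Fin n → Node (h T)) lit → satL T I σ lit → satL T I (embed e ∘ σ) lit
    satL-embed σ (eqL t u) t≡u = trans (eval-embed σ t) (trans (cong (embed e) t≡u) (sym (eval-embed σ u)))
    satL-embed σ (neqL t u) t≢u t≡u =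
      t≢u (embed-injective e _ _ (trans (sym (eval-embed σ t)) (trans t≡u (eval-embed σ u))))
    satL-embed σ (edgeL t u) t→u =
      subst₂ Edge (sym (eval-embed σ t)) (sym (eval-embed σ u)) (Equivalence.to (Edge-embed e _ _) t→u)
    satL-embed σ (nedgeL t u) ¬t→u t→u =
      ¬t→u (Equivalence.from (Edge-embed e _ _) (subst₂ Edge (eval-embed σ t) (eval-embed σ u) t→u))
    satL-embed σ (relL i ts) r =
      subst (R T i) (sym (map-eval-embed σ ts)) (saturated T i _ _ (sym (map-depth-embed e _)) r)
    satL-embed σ (nrelL i ts) ¬r r =
      ¬r (saturated T i _ _ (map-depth-embed e _) (subst (R T i) (map-eval-embed σ ts) r))
    satL-embed σ (intL P ts) x = subst (λ v → I (P , v)) (sym (map-eval-embed σ ts)) (I-embed P _ x)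
    satL-embed σ (allL P t s eq zs) x ys =
      subst (λ z → I (P , V.cast (sym eq) (ys ++ z))) (sym (map-eval-embed σ zs)) (∀-closed-embed P t s eq _ x ys)

    consequence-embed : ∀ Π P as → consequence I Π (P , as) → consequence I Π (P , V.map (embed e) as)
    consequence-embed Π P as = Any.map λ { {ρ} (σ , refl , body-sat) → embed e ∘ σ
      , cong (head ρ ,_) (V.map-∘ (embed e) σ (hargs ρ))
      , All.map (λ {lit} → satL-embed σ lit) body-sat }

  stage-charT : ∀ Π j P → CharDetermined (λ as → stage T Π j (P , as))
  stage-charT Π (suc j) P as bs e with charT-homogeneous as bs e
  ... | f , refl =
    consequence-embed (RootedIsometry⇒DepthEmbedding f) (stage T Π j) stage-apply ∀-closed-apply Π P as
    where
    stage-apply : ∀ P as → stage T Π j (P , as) → stage T Π j (P , V.map (apply f) as)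
    stage-apply P as = stage-charT Π j P as _ (sym (charT-apply f as))
    ∀-closed-apply : ∀ P t s eq zs → ∀-closed-lit (stage T Π j) P t s eq zs →
      ∀-closed-lit (stage T Π j) P t s eq (V.map (apply f) zs)
    ∀-closed-apply P t s eq zs H ys with charT-extend ys (V.map (apply f) zs) zs (charT-apply f zs)
    ... | ys′ , e′ = stage-charT Π j P _ _ (charT-cast (sym eq) _ _ e′) (H ys′)

  stage-invariant : ∀ Π j (A : Automorphism (h T)) P as → stage T Π j (P , as) → stage T Π j (P , V.map (to A) as)
  stage-invariant Π (suc j) A = consequence-embed (Automorphism⇒DepthEmbedding (h≥1 T) A) (stage T Π j)
    (stage-invariant Π j A) ∀-closed-to Π
    where
    ∀-closed-to : ∀ P t s eq zs → ∀-closed-lit (stage T Π j) P t s eq zs →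
      ∀-closed-lit (stage T Π j) P t s eq (V.map (to A) zs)
    ∀-closed-to P t s eq zs H ys =
      subst (λ v → stage T Π j (P , v)) to-from-ys (stage-invariant Π j A P _ (H (V.map (from A) ys)))
      where
      open ≡-Reasoning
      to-from-ys : V.map (to A) (V.cast (sym eq) (V.map (from A) ys ++ zs)) ≡ V.cast (sym eq) (ys ++ V.map (to A) zs)
      to-from-ys = begin
        V.map (to A) (V.cast (sym eq) (V.map (from A) ys ++ zs))
          ≡⟨ V.map-cast (to A) (sym eq) _ ⟩
        V.cast (sym eq) (V.map (to A) (V.map (from A) ys ++ zs))
          ≡⟨ cong (V.cast (sym eq)) (V.map-++ (to A) _ zs) ⟩
        V.cast (sym eq) (V.map (to A) (V.map (from A) ys) ++ V.map (to A) zs)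
          ≡⟨ cong (λ w → V.cast (sym eq) (w ++ V.map (to A) zs)) (map-to-from A ys) ⟩
        V.cast (sym eq) (ys ++ V.map (to A) zs) ∎

  value-charT : ∀ Π P → CharDetermined (value T Π P)
  value-charT Π P as bs e (j , st) = j , stage-charT Π j P as bs e st

  value-invariant : ∀ Π P → Invariant (value T Π P)
  value-invariant Π P A as = mk⇔
    (λ (j , st) → j , stage-invariant Π j A P as st)
    (λ (j , st) → j , subst (λ v → stage T Π j (P , v)) (map-to-from (Automorphism-inverse A) as)
                             (stage-invariant Π j (Automorphism-inverse A) P _ st))

-- The translation Π ↦ Π^*

module _ {n : ℕ} where

  minmax-self : (x : Fin n) → minmax x x ≡ (x , x)
  minmax-self x with toℕ x ≤? toℕ x
  ... | yes _ = refl
  ... | no _ = refl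

  minmax-comm : (x y : Fin n) → minmax x y ≡ minmax y x
  minmax-comm x y with toℕ x ≤? toℕ y | toℕ y ≤? toℕ x
  ... | yes x≤y | yes y≤x = cong₂ _,_ x≡y (sym x≡y)
    where x≡y = Fin.toℕ-injective (ℕ.≤-antisym x≤y y≤x)
  ... | yes _   | no _    = refl
  ... | no _    | yes _   = refl
  ... | no x≰y  | no y≰x  = ⊥-elim (x≰y (ℕ.≰⇒≥ y≰x))

  minmax-symmetric : ∀ {A : Set} (k : Fin n × Fin n → A) (g : Fin n → Fin n → A) →
    (∀ x y → k (x , y) ≡ g x y) → (∀ x y → g x y ≡ g y x) → ∀ x y → k (minmax x y) ≡ g x y
  minmax-symmetric k g k≗g g-comm x y with toℕ x ≤? toℕ y
  ... | yes _ = k≗g x y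
  ... | no _ = trans (k≗g y x) (g-comm y x)

satAll-++ : ∀ {S} {T : Tree S} {m X J} {τ : X → Fin (h T)} (φs ψs : List (Fo S m X)) →
  satAll T m J τ (φs L.++ ψs) ⇔ (satAll T m J τ φs × satAll T m J τ ψs)
satAll-++ [] ψs = mk⇔ (tt ,_) proj₂
satAll-++ (φ ∷ φs) ψs = mk⇔
  (λ (a , rest) → let (b , c) = Equivalence.to (satAll-++ φs ψs) rest in (a , b) , c)
  (λ ((a , b) , c) → a , Equivalence.from (satAll-++ φs ψs) (b , c))

module _ {S : Schema} (Π : Program S) where

  nv≤mOf : All.All (λ ρ → nv ρ ≤ mOf Π) Π
  nv≤mOf = All.map (λ le → ℕ.≤-trans le (ℕ.m≤m⊔n _ _)) (≤-maxList Π)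
    where
    ≤-maxList : ∀ ρs → All.All (λ ρ → nv ρ ≤ maxList (L.map nv ρs)) ρs
    ≤-maxList [] = []
    ≤-maxList (ρ ∷ ρs) = ℕ.m≤m⊔n (nv ρ) _ ∷ All.map (λ le → ℕ.≤-trans le (ℕ.m≤n⊔m (nv ρ) _)) (≤-maxList ρs)

  pAr≤mOf : ∀ P → pAr S P ≤ mOf Π
  pAr≤mOf P = ℕ.≤-trans (≤-maxFin (pAr S) P)
    (ℕ.≤-trans (ℕ.m≤n⊔m (maxFin (rAr S)) _) (ℕ.m≤n⊔m (maxList (L.map nv Π)) _))
    where
    ≤-maxFin : ∀ {k} (f : Fin k → ℕ) i → f i ≤ maxFin f
    ≤-maxFin f fzero = ℕ.m≤m⊔n _ _
    ≤-maxFin f (fsuc i) = ℕ.≤-trans (≤-maxFin (f ∘ fsuc) i) (ℕ.m≤n⊔m (f fzero) _)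

module _ {S : Schema} (T : Tree S) (m : ℕ) where

  sconsequence : (SFact T m → Set) → SProgram S m → SFact T m → Set
  sconsequence J Π* fact = Σ (Fin (L.length Π*)) λ i → ∃ λ (τ : X (L.lookup Π* i) → Fin (h T)) →
    ((shead (L.lookup Π* i) , V.map τ (sargs (L.lookup Π* i))) ≡ fact) × satAll T m J τ (sbody (L.lookup Π* i))

  module _ {X A : Set} (τ : X → Fin (h T)) (f : A → STm X) (g : A → A → STm X) where

    private
      eval = evalS T m τ

    map-eval-charShape : ∀ (ν : A → Node (h T)) → (∀ a → eval (f a) ≡ depth (ν a)) →
      (∀ a b → eval (g a b) ≡ lcaDepth (ν a) (ν b)) → ∀ {r} (w : Vec A r) →
      V.map eval (charShape f g w) ≡ charT (V.map ν w)
    map-eval-charShape ν f≗ g≗ w = trans (map-charShape eval f g w)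
      (trans (charShape-cong f≗ g≗ w) (sym (charShape-map ν depth lcaDepth w)))

    ful-sat : ∀ (ν : A → Node (h T)) → (∀ a → eval (f a) ≡ depth (ν a)) →
      (∀ a b → eval (g a b) ≡ lcaDepth (ν a) (ν b)) → ∀ {r} (w : Vec A (suc r)) →
      semR T m fulR (V.map eval (charShape f g (padLast m w)))
    ful-sat ν f≗ g≗ w = padLast m (V.map ν w) , tt ,
      trans (cong charT (padLast-map m ν w)) (sym (map-eval-charShape ν f≗ g≗ (padLast m w)))

    ful-realise : ∀ {r} → suc r ≤ m → (w : Vec A (suc r)) →
      semR T m fulR (V.map eval (charShape f g (padLast m w))) →
      Σ (Vec (Node (h T)) (suc r)) λ ws → charT ws ≡ V.map eval (charShape f g w)
    ful-realise r<m w (bs , _ , e) = V.truncate r<m bs , (begin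
      charT (V.truncate r<m bs)                                       ≡⟨ charShape-truncate r<m bs (padLast m w) e′ ⟩
      charShape (eval ∘ f) (λ a b → eval (g a b)) (V.truncate r<m (padLast m w))
                                                                      ≡⟨ cong (charShape _ _) (truncate-padWith r<m (V.last w) w) ⟩
      charShape (eval ∘ f) (λ a b → eval (g a b)) w                   ≡⟨ map-charShape eval f g w ⟨
      V.map eval (charShape f g w)                                    ∎)
      where
      open ≡-Reasoning
      e′ : charT bs ≡ charShape (eval ∘ f) (λ a b → eval (g a b)) (padLast m w)
      e′ = trans e (map-charShape eval f g (padLast m w))

module Translation {S : Schema} (Π : Program S) (T : Tree S) where

  private
    m = mOf Π
    Nd = Node (h T)
    D = Fin (h T)
    eval : ∀ {X} → (X → D) → STm X → D
    eval = evalS T m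

  open Translate {S} m using (IV; iT; iP; ful; Blk; Ent; up; bT; bP; trL; trRule)

  record Realises {n} (σ : Fin n → Nd) (τ : IV n → D) : Set where
    constructor realises
    field minmax-lcaDepth : ∀ x y → τ (minmax x y) ≡ lcaDepth (σ x) (σ y)
  open Realises

  lcaDepths-realises : ∀ {n} (σ : Fin n → Nd) → Realises σ (λ (x , y) → lcaDepth (σ x) (σ y))
  lcaDepths-realises σ = realises
    (minmax-symmetric _ (λ x y → lcaDepth (σ x) (σ y)) (λ _ _ → refl) (λ x y → lcaDepth-comm (σ x) (σ y)))

  module _ {n} {σ : Fin n → Nd} {τ : IV n → D} (σ⊨τ : Realises σ τ) where

    eval-iT : ∀ t → eval τ (iT t) ≡ depth (evalT T σ t)
    eval-iT (var x) = trans (cong τ (sym (minmax-self x))) (trans (minmax-lcaDepth σ⊨τ x x) (lcaDepth-self (σ x)))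
    eval-iT root = refl

    eval-iP : ∀ t u → eval τ (iP t u) ≡ lcaDepth (evalT T σ t) (evalT T σ u)
    eval-iP (var x) (var y) = minmax-lcaDepth σ⊨τ x y
    eval-iP (var x) root = sym (lcaDepth-rootʳ (σ x) (h≥1 T))
    eval-iP root u = sym (lcaDepth-rootˡ (evalT T σ u) (h≥1 T))

    eval-star : ∀ {r} (ts : Vec (Term n) r) → V.map (eval τ) (charShape iT iP ts) ≡ charT (V.map (evalT T σ) ts)
    eval-star = map-eval-charShape T m τ iT iP (evalT T σ) eval-iT eval-iP

    map-sargs : ∀ {r} (xs : Vec (Fin n) r) → V.map τ (charShape (λ x → x , x) minmax xs) ≡ charT (V.map σ xs)
    map-sargs xs = trans (map-charShape τ _ minmax xs)
      (trans (charShape-cong (eval-iT ∘ var) (minmax-lcaDepth σ⊨τ) xs) (sym (charShape-map σ depth lcaDepth xs)))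

    ful-terms-sat : ∀ {J r} (ts : Vec (Term n) r) → satAll T m J τ (ful iT iP ts)
    ful-terms-sat [] = tt
    ful-terms-sat (t ∷ ts) = ful-sat T m τ iT iP (evalT T σ) eval-iT eval-iP (t ∷ ts) , tt

  realise : ∀ {n J} → n ≤ m → (τ : IV n → D) → satAll T m J τ (ful iT iP (V.map var (V.allFin n))) →
    Σ (Fin n → Nd) λ σ → Realises σ τ
  realise {zero} _ τ _ = (λ ()) , realises (λ ())
  realise {suc n} n≤m τ (fulτ , _) with ful-realise T m τ iT iP n≤m (V.map var (V.allFin (suc n))) fulτ
  ... | ws , e = V.lookup ws , realises σ⊨τ
    where
    e′ : charT ws ≡ charShape (λ x → τ (x , x)) (λ x y → τ (minmax x y)) (V.allFin (suc n))
    e′ = trans e (trans (map-charShape (eval τ) iT iP (V.map var (V.allFin (suc n))))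
      (charShape-map var (eval τ ∘ iT) (λ a b → eval τ (iP a b)) (V.allFin (suc n))))
    lookup-ws = charShape-lookup ws (V.allFin (suc n)) e′
    on-diagonal : ∀ x → τ (minmax x x) ≡ lcaDepth (V.lookup ws x) (V.lookup ws x)
    on-diagonal x = trans (cong τ (minmax-self x))
      (trans (sym (trans (proj₁ lookup-ws x) (cong (λ a → τ (a , a)) (V.lookup-allFin x)))) (sym (lcaDepth-self (V.lookup ws x))))
    above-diagonal : ∀ x y → toℕ x < toℕ y → τ (minmax x y) ≡ lcaDepth (V.lookup ws x) (V.lookup ws y)
    above-diagonal x y x<y =
      sym (trans (proj₂ lookup-ws x y x<y) (cong₂ (λ a b → τ (minmax a b)) (V.lookup-allFin x) (V.lookup-allFin y)))
    σ⊨τ : ∀ x y → τ (minmax x y) ≡ lcaDepth (V.lookup ws x) (V.lookup ws y)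
    σ⊨τ x y with ℕ.<-cmp (toℕ x) (toℕ y)
    ... | tri< x<y _ _ = above-diagonal x y x<y
    ... | tri> _ _ y<x = trans (cong τ (minmax-comm x y))
      (trans (above-diagonal y x y<x) (lcaDepth-comm (V.lookup ws y) (V.lookup ws x)))
    ... | tri≈ _ x≡y _ with Fin.toℕ-injective x≡y
    ...   | refl = on-diagonal x

  module _ (I : Fact T → Set) (J : SFact T m → Set)
    (I-charT : ∀ P → CharDetermined (λ as → I (P , as)))
    (I⇔J : ∀ P c → charSet (λ as → I (P , as)) c ⇔ J (P , c)) where

    private
      ⇔×⊤ : ∀ {A : Set} → A ⇔ (A × ⊤)
      ⇔×⊤ = mk⇔ (_, tt) proj₁

      three-depths : ∀ {R₁ R₂ : D → D → Set} {a a′ d d′ b b′} → a ≡ a′ → d ≡ d′ → b ≡ b′ →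
        (R₁ a′ d′ × R₂ d′ b′) ⇔ (R₁ a d × R₂ d b × ⊤)
      three-depths refl refl refl = mk⇔ (λ (x , y) → x , y , tt) (λ (x , y , _) → x , y)

    module _ {n} {σ : Fin n → Nd} {τ : IV n → D} (σ⊨τ : Realises σ τ) where

      private
        ev = evalT T σ

      charSet-star : ∀ {r} {R : Vec Nd r → Set} → CharDetermined R → (ts : Vec (Term n) r) →
        R (V.map ev ts) ⇔ charSet R (V.map (eval τ) (charShape iT iP ts))
      charSet-star {R = R} det ts = subst (λ c → R (V.map ev ts) ⇔ charSet R c) (sym (eval-star σ⊨τ ts))
        (⇔-sym (charSet-charT det (V.map ev ts)))

      module ForAll (P : Fin (p S)) (t s : ℕ) (eq : pAr S P ≡ suc t + s) (zs : Vec (Term n) s) where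

        ents : Vec (Ent {n} {suc t}) (suc t + s)
        ents = V.map inj₁ (V.allFin (suc t)) ++ V.map inj₂ zs

        BlockSat : Set
        BlockSat = ∀ (β : Blk {n} {suc t} → D) →
          semR T m fulR (V.map (eval [ τ , β ]) (charShape bT bP (padLast m ents))) →
          J (P , V.map (eval [ τ , β ]) (charShape bT bP (V.cast (sym eq) ents)))

        private
          zσ = V.map ev zs

          eval-up : ∀ (β : Blk {n} {suc t} → D) x → eval [ τ , β ] (up x) ≡ eval τ x
          eval-up β (tv x) = refl
          eval-up β t0 = refl

          eval-zs : ∀ β → V.map (eval [ τ , β ]) (charShape bT bP (V.map inj₂ zs)) ≡ charT zσ
          eval-zs β = trans (cong (V.map (eval [ τ , β ])) (charShape-map inj₂ bT bP zs))
            (map-eval-charShape T m [ τ , β ] (bT ∘ inj₂) (λ z u → bP (inj₂ z) (inj₂ u)) ev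
              (λ z → trans (eval-up β (iT z)) (eval-iT σ⊨τ z))
              (λ z u → trans (eval-up β (iP z u)) (eval-iP σ⊨τ z u)) zs)

          map-eval-cast : ∀ (β : Blk {n} {suc t} → D) → V.map (eval [ τ , β ]) (charShape bT bP (V.cast (sym eq) ents))
            ≡ V.cast (cong charLen (sym eq)) (V.map (eval [ τ , β ]) (charShape bT bP ents))
          map-eval-cast β = trans (cong (V.map (eval [ τ , β ])) (charShape-cast bT bP (sym eq) ents))
            (V.map-cast (eval [ τ , β ]) (cong charLen (sym eq)) _)

          charT-suffix : ∀ β (wy : Vec Nd (suc t)) (wz : Vec Nd s) →
            charT (wy ++ wz) ≡ V.map (eval [ τ , β ]) (charShape bT bP ents) → charT wz ≡ charT zσ
          charT-suffix β wy wz e = trans (charShape-++-injectiveʳ wy wz (V.map inj₁ (V.allFin (suc t))) (V.map inj₂ zs)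
              (trans e (map-charShape (eval [ τ , β ]) bT bP ents)))
            (trans (sym (map-charShape (eval [ τ , β ]) bT bP (V.map inj₂ zs))) (eval-zs β))

        -- FUL_m makes β the characteristic data of some wy ++ wz; wz need not be zσ, but it has the
        -- same characteristic tuple, so charT-extend moves wy to a witness ys over zσ.
        forall-complete : satL T I σ (allL P t s eq zs) → BlockSat
        forall-complete H β fulβ
          with ful-realise T m [ τ , β ] bT bP (subst (_≤ m) eq (pAr≤mOf Π P)) ents fulβ
        ... | ws , ews with V.splitAt (suc t) ws
        ...   | wy , wz , refl with charT-extend wy wz zσ (charT-suffix β wy wz ews)
        ...     | ys , eys = Equivalence.to (I⇔J P _) (V.cast (sym eq) (ys ++ zσ) , H ys , (begin
          charT (V.cast (sym eq) (ys ++ zσ))                   ≡⟨ charShape-cast depth lcaDepth (sym eq) (ys ++ zσ) ⟩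
          V.cast _ (charT (ys ++ zσ))                          ≡⟨ cong (V.cast _) (trans eys ews) ⟩
          V.cast _ (V.map (eval [ τ , β ]) (charShape bT bP ents)) ≡⟨ map-eval-cast β ⟨
          V.map (eval [ τ , β ]) (charShape bT bP (V.cast (sym eq) ents)) ∎))
          where open ≡-Reasoning

        private
          blockDepths : Vec Nd (suc t) → Blk {n} {suc t} → D
          blockDepths ys (inj₁ (j , l)) = lcaDepth (V.lookup ys j) (V.lookup ys l)
          blockDepths ys (inj₂ (j , x)) = lcaDepth (V.lookup ys j) (σ x)

          entryNode : Vec Nd (suc t) → Ent {n} {suc t} → Nd
          entryNode ys (inj₁ j) = V.lookup ys j
          entryNode ys (inj₂ z) = ev z

          module _ (ys : Vec Nd (suc t)) where
            eval-bT : ∀ x → eval [ τ , blockDepths ys ] (bT x) ≡ depth (entryNode ys x)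
            eval-bT (inj₁ j) = lcaDepth-self (V.lookup ys j)
            eval-bT (inj₂ z) = trans (eval-up (blockDepths ys) (iT z)) (eval-iT σ⊨τ z)

            eval-bP : ∀ x y → eval [ τ , blockDepths ys ] (bP x y) ≡ lcaDepth (entryNode ys x) (entryNode ys y)
            eval-bP (inj₁ j) (inj₁ l) =
              minmax-symmetric (blockDepths ys ∘ inj₁) (λ a b → lcaDepth (V.lookup ys a) (V.lookup ys b)) (λ _ _ → refl) (λ a b → lcaDepth-comm (V.lookup ys a) (V.lookup ys b)) j l
            eval-bP (inj₁ j) (inj₂ (var x)) = refl
            eval-bP (inj₁ j) (inj₂ root) = sym (lcaDepth-rootʳ (V.lookup ys j) (h≥1 T))
            eval-bP (inj₂ (var x)) (inj₁ j) = lcaDepth-comm (V.lookup ys j) (σ x)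
            eval-bP (inj₂ root) (inj₁ j) = sym (lcaDepth-rootˡ (V.lookup ys j) (h≥1 T))
            eval-bP (inj₂ z) (inj₂ u) = trans (eval-up (blockDepths ys) (iP z u)) (eval-iP σ⊨τ z u)

            entryNode-ents : V.map (entryNode ys) ents ≡ ys ++ zσ
            entryNode-ents = trans (V.map-++ (entryNode ys) (V.map inj₁ (V.allFin (suc t))) (V.map inj₂ zs))
              (cong₂ _++_ (trans (sym (V.map-∘ (entryNode ys) inj₁ (V.allFin (suc t)))) (V.map-lookup-allFin ys))
                          (sym (V.map-∘ (entryNode ys) inj₂ zs)))

        forall-sound : BlockSat → satL T I σ (allL P t s eq zs)
        forall-sound H ys = Equivalence.to (charSet-charT (I-charT P) _)
          (subst (charSet (λ as → I (P , as))) eval-ents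
            (Equivalence.from (I⇔J P _)
              (H β (ful-sat T m [ τ , β ] bT bP (entryNode ys) (eval-bT ys) (eval-bP ys) ents))))
          where
          β = blockDepths ys
          open ≡-Reasoning
          eval-ents : V.map (eval [ τ , β ]) (charShape bT bP (V.cast (sym eq) ents)) ≡ charT (V.cast (sym eq) (ys ++ zσ))
          eval-ents = begin
            V.map (eval [ τ , β ]) (charShape bT bP (V.cast (sym eq) ents))
              ≡⟨ map-eval-charShape T m [ τ , β ] bT bP (entryNode ys) (eval-bT ys) (eval-bP ys) (V.cast (sym eq) ents) ⟩
            charT (V.map (entryNode ys) (V.cast (sym eq) ents))
              ≡⟨ cong charT (trans (V.map-cast (entryNode ys) (sym eq) ents) (cong (V.cast (sym eq)) (entryNode-ents ys))) ⟩
            charT (V.cast (sym eq) (ys ++ zσ)) ∎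

      satL⇔trL : ∀ lit → satL T I σ lit ⇔ satAll T m J τ (trL lit)
      satL⇔trL (eqL t u) = ⇔-trans (≡⇔depths (ev t) (ev u))
        (three-depths {R₁ = _≡_} {R₂ = _≡_} (eval-iT σ⊨τ t) (eval-iP σ⊨τ t u) (eval-iT σ⊨τ u))
      satL⇔trL (edgeL t u) = ⇔-trans (Edge⇔depths (ev t) (ev u))
        (three-depths {R₁ = _≡_} {R₂ = λ d b → toℕ b ≡ suc (toℕ d)} (eval-iT σ⊨τ t) (eval-iP σ⊨τ t u) (eval-iT σ⊨τ u))
      satL⇔trL (neqL t u) = ⇔-trans (charSet-star (isometry-closed⇒CharDetermined
        λ { f (a ∷ b ∷ []) a≢b fa≡fb → a≢b (apply-injective f a b fa≡fb) }) (t ∷ u ∷ [])) ⇔×⊤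
      satL⇔trL (nedgeL t u) = ⇔-trans (charSet-star (isometry-closed⇒CharDetermined
        λ { f (a ∷ b ∷ []) ¬a→b fa→fb → ¬a→b (Equivalence.from (Edge-apply f a b) fa→fb) }) (t ∷ u ∷ [])) ⇔×⊤
      satL⇔trL (relL i ts) = ⇔-trans (charSet-star (isometry-closed⇒CharDetermined
        λ f as → saturated T i as _ (sym (map-depth-embed (RootedIsometry⇒DepthEmbedding f) as))) ts) ⇔×⊤
      satL⇔trL (nrelL i ts) = ⇔-trans (charSet-star (isometry-closed⇒CharDetermined
        λ f as ¬R R′ → ¬R (saturated T i _ as (map-depth-embed (RootedIsometry⇒DepthEmbedding f) as) R′)) ts) ⇔×⊤
      satL⇔trL (intL P ts) = ⇔-trans (charSet-star (I-charT P) ts) (⇔-trans (I⇔J P _) ⇔×⊤)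
      satL⇔trL (allL P t s eq zs) = mk⇔
        (λ H → Equivalence.from (satAll-++ (ful iT iP zs) _) (ful-terms-sat σ⊨τ zs , forall-complete H , tt))
        (λ sat → forall-sound (proj₁ (proj₂ (Equivalence.to (satAll-++ (ful iT iP zs) _) sat))))
        where open ForAll P t s eq zs

      body⇔trL : ∀ lits → All.All (satL T I σ) lits ⇔ satAll T m J τ (L.concatMap trL lits)
      body⇔trL [] = mk⇔ (λ _ → tt) (λ _ → [])
      body⇔trL (lit ∷ lits) = mk⇔
        (λ { (x ∷ xs) → Equivalence.from (satAll-++ (trL lit) _)
          (Equivalence.to (satL⇔trL lit) x , Equivalence.to (body⇔trL lits) xs) })
        (λ sat → let (x , xs) = Equivalence.to (satAll-++ (trL lit) _) sat in
          Equivalence.from (satL⇔trL lit) x ∷ Equivalence.from (body⇔trL lits) xs)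

    rule-sound : ∀ ρ (σ : Fin (nv ρ) → Nd) → All.All (satL T I σ) (body ρ) →
      ∃ λ (τ : IV (nv ρ) → D) →
        (V.map τ (sargs (trRule ρ)) ≡ charT (V.map σ (hargs ρ))) × satAll T m J τ (sbody (trRule ρ))
    rule-sound ρ σ body-sat = _ , map-sargs σ⊨τ (hargs ρ) ,
      Equivalence.from (satAll-++ (ful iT iP (V.map var (V.allFin (nv ρ)))) _)
        (ful-terms-sat σ⊨τ (V.map var (V.allFin (nv ρ))) , Equivalence.to (body⇔trL σ⊨τ (body ρ)) body-sat)
      where σ⊨τ = lcaDepths-realises σ

    rule-complete : ∀ ρ → nv ρ ≤ m → (τ : IV (nv ρ) → D) → satAll T m J τ (sbody (trRule ρ)) →
      ∃ λ (σ : Fin (nv ρ) → Nd) →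
        (V.map τ (sargs (trRule ρ)) ≡ charT (V.map σ (hargs ρ))) × All.All (satL T I σ) (body ρ)
    rule-complete ρ nv≤m τ sat with Equivalence.to (satAll-++ (ful iT iP (V.map var (V.allFin (nv ρ)))) _) sat
    ... | ful-holds , body-sat with realise nv≤m τ ful-holds
    ...   | σ , σ⊨τ = σ , map-sargs σ⊨τ (hargs ρ) , Equivalence.from (body⇔trL σ⊨τ (body ρ)) body-sat

    consequence⇔ : ∀ Π′ → All.All (λ ρ → nv ρ ≤ m) Π′ → ∀ P c →
      charSet (λ as → consequence T I Π′ (P , as)) c ⇔ sconsequence T m J (L.map trRule Π′) (P , c)
    consequence⇔ Π′ bounded P c = mk⇔ (sound Π′) (complete Π′ bounded)
      where
      sound : ∀ Π′ → charSet (λ as → consequence T I Π′ (P , as)) c → sconsequence T m J (L.map trRule Π′) (P , c)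
      sound (ρ ∷ Π′) (as , here (σ , refl , body-sat) , refl) with rule-sound ρ σ body-sat
      ... | τ , head≡ , sat = fzero , τ , cong (head ρ ,_) head≡ , sat
      sound (ρ ∷ Π′) (as , there cons , e) with sound Π′ (as , cons , e)
      ... | i , rest = fsuc i , rest

      complete : ∀ Π′ → All.All (λ ρ → nv ρ ≤ m) Π′ →
        sconsequence T m J (L.map trRule Π′) (P , c) → charSet (λ as → consequence T I Π′ (P , as)) c
      complete (ρ ∷ Π′) (nv≤m ∷ _) (fzero , τ , refl , sat) with rule-complete ρ nv≤m τ sat
      ... | σ , head≡ , body-sat = V.map σ (hargs ρ) , here (σ , refl , body-sat) , sym head≡
      complete (ρ ∷ Π′) (_ ∷ bounded) (fsuc i , rest) with complete Π′ bounded (i , rest)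
      ... | as , cons , e = as , there cons , e

  stage⇔sstage : ∀ j P c → charSet (λ as → stage T Π j (P , as)) c ⇔ sstage T m (star Π) j (P , c)
  stage⇔sstage zero P c = mk⇔ (λ ()) (λ ())
  stage⇔sstage (suc j) P c =
    consequence⇔ (stage T Π j) (sstage T m (star Π) j) (stage-charT T Π j) (stage⇔sstage j) Π (nv≤mOf Π) P c

  value⇔svalue : ∀ P c → charSet (value T Π P) c ⇔ svalue T m (star Π) P c
  value⇔svalue P c = mk⇔
    (λ (as , (j , st) , e) → j , Equivalence.to (stage⇔sstage j P c) (as , st , e))
    (λ (j , sst) → let (as , st , e) = Equivalence.from (stage⇔sstage j P c) sst in as , (j , st) , e)

  models⇔smodels : ∀ P (e : pAr S P ≡ 0) → models T Π P e ⇔ smodels T m (star Π) P e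
  models⇔smodels P e = ⇔-trans (⇔-sym (charSet-charT (value-charT T Π P) (V.cast (sym e) [])))
    (subst (λ c → charSet (value T Π P) (charT (V.cast (sym e) [])) ⇔ svalue T m (star Π) P c)
      (charShape-cast depth lcaDepth (sym e) []) (value⇔svalue P _))

proposition4 : (S : Schema) (Π : Program S) → WellFormed Π →
    (T : Tree S) (P : Fin (Schema.p S)) →
      Invariant (value T Π P)
      × (∀ (c : Vec (Fin (Tree.h T)) (charLen (Schema.pAr S P))) →
           charSet (value T Π P) c ⇔ svalue T (mOf Π) (star Π) P c)
      × ((e : Schema.pAr S P ≡ 0) → models T Π P e ⇔ smodels T (mOf Π) (star Π) P e)
proposition4 S Π _ T P = value-invariant T Π P , value⇔svalue P , models⇔smodels P
  where open Translation Π T
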